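{- If $\cdot\mid\cdot\vdash e:\forall\alpha.\,\alpha\twoheadrightarrow(\alpha\twoheadrightarrow(\alpha\bullet\alpha))$, then $e$ is extensionally equivalent to $\lambda x.\,\lambda y.\,(x,y)$, i.e., for all closed values $v,w$ the expression $e\,v\,w$ evaluates to $(v,w)$.
   Context: Untyped expressions: $e ::= x \mid (e_1,e_2) \mid \mathbf{match}\; e\; ((x,y)\Rightarrow e') \mid \lambda x.\,e \mid e_1\,e_2$; application is left-associative. Values are $\lambda x.\,e$ and pairs of values. Call-by-value big-step evaluation $e\hookrightarrow v$: $\lambda x.e \hookrightarrow \lambda x.e$; $e_1\,e_2\hookrightarrow v$ if $e_1\hookrightarrow\lambda x.e_1'$, $e_2\hookrightarrow v_2$, $[v_2/x]e_1'\hookrightarrow v$; $(e_1,e_2)\hookrightarrow(v_1,v_2)$ if $e_i\hookrightarrow v_i$; $\mathbf{match}\;e\;((x,y)\Rightarrow e')\hookrightarrow v'$ if $e\hookrightarrow(v_1,v_2)$ and $[v_1/x,v_2/y]e'\hookrightarrow v'$. Types: $A,B ::= \alpha \mid A\bullet B \mid A\backslash B \mid A\twoheadrightarrow B \mid \forall\alpha.\,A$. Ordered typing judgment $\Delta\mid\Omega\vdash e:A$: $\Delta$ a list of type variables, $\Omega$ an ordered list of distinct typed variables (juxtaposition = concatenation). Rules: (hyp) $\Delta\mid x:A\vdash x:A$. ($\twoheadrightarrow$I) from $\Delta\mid\Omega\,(x:A)\vdash e:B$ infer $\Delta\mid\Omega\vdash\lambda x.e:A\twoheadrightarrow B$. ($\twoheadrightarrow$E)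 from $\Delta\mid\Omega\vdash e_1:A\twoheadrightarrow B$ and $\Delta\mid\Omega_A\vdash e_2:A$ infer $\Delta\mid\Omega\,\Omega_A\vdash e_1\,e_2:B$. ($\backslash$I) from $\Delta\mid(x:A)\,\Omega\vdash e:B$ infer $\Delta\mid\Omega\vdash\lambda x.e:A\backslash B$. ($\backslash$E) from $\Delta\mid\Omega\vdash e_1:A\backslash B$ and $\Delta\mid\Omega_A\vdash e_2:A$ infer $\Delta\mid\Omega_A\,\Omega\vdash e_1\,e_2:B$. ($\bullet$I) from $\Delta\mid\Omega_A\vdash e_1:A$ and $\Delta\mid\Omega_B\vdash e_2:B$ infer $\Delta\mid\Omega_A\,\Omega_B\vdash(e_1,e_2):A\bullet B$. ($\bullet$E) from $\Delta\mid\Omega\vdash e:A\bullet B$ and $\Delta\mid\Omega_L\,(x:A)\,(y:B)\,\Omega_R\vdash e':C$ infer $\Delta\mid\Omega_L\,\Omega\,\Omega_R\vdash\mathbf{match}\;e\;((x,y)\Rightarrow e'):C$. ($\forall$I) from $\Delta,\alpha\,\mathsf{type}\mid\Omega\vdash e:A$ infer $\Delta\mid\Omega\vdash e:\forall\alpha.A$. ($\forall$E) from $\Delta\mid\Omega\vdash e:\forall\alpha.A(\alpha)$ and $B$ a type over $\Delta$ infer $\Delta\mid\Omega\vdash e:A(B)$. -}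

module Defs where

open import Data.Nat using (ℕ; zero; suc; _≟_)
open import Data.Fin using (Fin; zero; suc)
open import Data.List using (List; []; _∷_; _++_; map; [_])
open import Data.List.Membership.Propositional using (_∈_)
open import Data.List.Relation.Unary.Unique.Propositional using (Unique)
open import Data.Product using (_×_; _,_; proj₁)
open import Relation.Nullary using (yes; no)

Var : Set
Var = ℕ

data Expr : Set where
  var   : Var → Expr
  pair  : Expr → Expr → Expr
  match : Expr → Var → Var → Expr → Expr   -- match e ((x,y) ⇒ e')
  lam   : Var → Expr → Expr
  app   : Expr → Expr → Expr

data Value : Expr → Set where
  v-lam  : ∀ {x e} → Value (lam x e)
  v-pair : ∀ {v w} → Value v → Value w → Value (pair v w)

data Scoped (Γ : List Var) : Expr → Set where
  s-var   : ∀ {x} → x ∈ Γ → Scoped Γ (var x)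
  s-pair  : ∀ {e₁ e₂} → Scoped Γ e₁ → Scoped Γ e₂ → Scoped Γ (pair e₁ e₂)
  s-match : ∀ {e x y e'} → Scoped Γ e → Scoped (x ∷ y ∷ Γ) e' →
            Scoped Γ (match e x y e')
  s-lam   : ∀ {x e} → Scoped (x ∷ Γ) e → Scoped Γ (lam x e)
  s-app   : ∀ {e₁ e₂} → Scoped Γ e₁ → Scoped Γ e₂ → Scoped Γ (app e₁ e₂)

Closed : Expr → Set
Closed = Scoped []

-- [v/x]e ; only ever used with closed v, so no capture can occur
[_/_]_ : Expr → Var → Expr → Expr
[ v / x ] var z with x ≟ z
... | yes _ = v
... | no  _ = var z
[ v / x ] pair e₁ e₂ = pair ([ v / x ] e₁) ([ v / x ] e₂)
[ v / x ] match e y z e' with x ≟ y | x ≟ z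
... | no _ | no _ = match ([ v / x ] e) y z ([ v / x ] e')
... | _    | _    = match ([ v / x ] e) y z e'
[ v / x ] lam y e with x ≟ y
... | yes _ = lam y e
... | no  _ = lam y ([ v / x ] e)
[ v / x ] app e₁ e₂ = app ([ v / x ] e₁) ([ v / x ] e₂)

-- Call-by-value big-step evaluation e ↪ v.
-- [v₁/x, v₂/y]e' is realised as [v₁/x]([v₂/y]e') (values are closed).
infix 4 _↪_
data _↪_ : Expr → Expr → Set where
  ev-lam   : ∀ {x e} → lam x e ↪ lam x e
  ev-app   : ∀ {e₁ e₂ x e₁' v₂ v} →
             e₁ ↪ lam x e₁' → e₂ ↪ v₂ → [ v₂ / x ] e₁' ↪ v →
             app e₁ e₂ ↪ v
  ev-pair  : ∀ {e₁ e₂ v₁ v₂} → e₁ ↪ v₁ → e₂ ↪ v₂ → pair e₁ e₂ ↪ pair v₁ v₂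
  ev-match : ∀ {e x y e' v₁ v₂ v'} →
             e ↪ pair v₁ v₂ → [ v₁ / x ] ([ v₂ / y ] e') ↪ v' →
             match e x y e' ↪ v'

-- Types, with type variables as de Bruijn indices; Ty n = types over a
-- type context Δ of length n.

data Ty (n : ℕ) : Set where
  tvar : Fin n → Ty n
  _•_  : Ty n → Ty n → Ty n
  _⧵_  : Ty n → Ty n → Ty n
  _↠_  : Ty n → Ty n → Ty n
  all  : Ty (suc n) → Ty n

infixr 5 _↠_ _⧵_
infixr 6 _•_

ext : ∀ {m n} → (Fin m → Fin n) → Fin (suc m) → Fin (suc n)
ext ρ zero    = zero
ext ρ (suc i) = suc (ρ i)

rename : ∀ {m n} → (Fin m → Fin n) → Ty m → Ty n
rename ρ (tvar i) = tvar (ρ i)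
rename ρ (A • B)  = rename ρ A • rename ρ B
rename ρ (A ⧵ B)  = rename ρ A ⧵ rename ρ B
rename ρ (A ↠ B)  = rename ρ A ↠ rename ρ B
rename ρ (all A)  = all (rename (ext ρ) A)

exts : ∀ {m n} → (Fin m → Ty n) → Fin (suc m) → Ty (suc n)
exts σ zero    = tvar zero
exts σ (suc i) = rename suc (σ i)

tsubst : ∀ {m n} → (Fin m → Ty n) → Ty m → Ty n
tsubst σ (tvar i) = σ i
tsubst σ (A • B)  = tsubst σ A • tsubst σ B
tsubst σ (A ⧵ B)  = tsubst σ A ⧵ tsubst σ B
tsubst σ (A ↠ B)  = tsubst σ A ↠ tsubst σ B
tsubst σ (all A)  = all (tsubst (exts σ) A)

_[_]ᵀ : ∀ {n} → Ty (suc n) → Ty n → Ty n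
A [ B ]ᵀ = tsubst σ A
  where
  σ : _ → _
  σ zero    = B
  σ (suc i) = tvar i

-- Ordered typing  Δ ∣ Ω ⊢ e ∶ A   (Δ given by its length n)

Ctx : ℕ → Set
Ctx n = List (Var × Ty n)

Distinct : ∀ {n} → Ctx n → Set
Distinct Ω = Unique (map proj₁ Ω)

wkCtx : ∀ {n} → Ctx n → Ctx (suc n)
wkCtx = map (λ { (x , A) → (x , rename suc A) })

infix 3 _∣_⊢_∶_
data _∣_⊢_∶_ (n : ℕ) : Ctx n → Expr → Ty n → Set where
  hyp  : ∀ {x A} → n ∣ [ (x , A) ] ⊢ var x ∶ A
  ↠I   : ∀ {Ω x A e B} → Distinct (Ω ++ [ (x , A) ]) →
         n ∣ Ω ++ [ (x , A) ] ⊢ e ∶ B →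
         n ∣ Ω ⊢ lam x e ∶ A ↠ B
  ↠E   : ∀ {Ω ΩA e₁ e₂ A B} → Distinct (Ω ++ ΩA) →
         n ∣ Ω ⊢ e₁ ∶ A ↠ B → n ∣ ΩA ⊢ e₂ ∶ A →
         n ∣ Ω ++ ΩA ⊢ app e₁ e₂ ∶ B
  ⧵I   : ∀ {Ω x A e B} → Distinct ((x , A) ∷ Ω) →
         n ∣ (x , A) ∷ Ω ⊢ e ∶ B →
         n ∣ Ω ⊢ lam x e ∶ A ⧵ B
  ⧵E   : ∀ {Ω ΩA e₁ e₂ A B} → Distinct (ΩA ++ Ω) →
         n ∣ Ω ⊢ e₁ ∶ A ⧵ B → n ∣ ΩA ⊢ e₂ ∶ A →
         n ∣ ΩA ++ Ω ⊢ app e₁ e₂ ∶ B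
  •I   : ∀ {ΩA ΩB e₁ e₂ A B} → Distinct (ΩA ++ ΩB) →
         n ∣ ΩA ⊢ e₁ ∶ A → n ∣ ΩB ⊢ e₂ ∶ B →
         n ∣ ΩA ++ ΩB ⊢ pair e₁ e₂ ∶ A • B
  •E   : ∀ {Ω ΩL ΩR e x y e' A B C} →
         Distinct (ΩL ++ Ω ++ ΩR) →
         Distinct (ΩL ++ (x , A) ∷ (y , B) ∷ ΩR) →
         n ∣ Ω ⊢ e ∶ A • B →
         n ∣ ΩL ++ (x , A) ∷ (y , B) ∷ ΩR ⊢ e' ∶ C →
         n ∣ ΩL ++ Ω ++ ΩR ⊢ match e x y e' ∶ C
  ∀I   : ∀ {Ω e A} → suc n ∣ wkCtx Ω ⊢ e ∶ A → n ∣ Ω ⊢ e ∶ all A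
  ∀E   : ∀ {Ω e A} → (B : Ty n) → n ∣ Ω ⊢ e ∶ all A → n ∣ Ω ⊢ e ∶ A [ B ]ᵀ

{-# OPTIONS --safe #-}
module Submission where

-- Instantiate α with a fresh base type ι whose only inhabitants are constants,
-- each typed by consuming its own entry of the ordered context; then e v w has
-- type ι • ι in the context (v , w). Derivations carry their size, and since
-- every variable of an ordered context is used exactly once, substituting a
-- derivation of size j for a variable in one of size k gives size k + j. Hence
-- each β-step strictly decreases size, and a derivation in a context of
-- constants evaluates to a value typed in the same context. A value of type
-- ι • ι in the context (v , w) is a pair of constants consuming that context in
-- order, i.e. (v , w).

open import Defs
open import Data.Fin using (zero)
open import Data.List using ([])

open import Data.Nat using (ℕ; suc; _+_; _≤_; _<_; s≤s; _≟_)
open import Data.Nat.Properties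
  using ( ≤-refl; ≤-reflexive; ≤-trans; <⇒≤; m≤m+n; m≤n+m; m<n⇒m<1+n
        ; +-assoc; +-comm; +-mono-≤; +-mono-<-≤; +-monoˡ-<; +-commutativeSemigroup )
open import Data.Nat.Induction using (<-rec; <-Rec)
open import Algebra.Properties.CommutativeSemigroup +-commutativeSemigroup using (xy∙z≈xz∙y; xy∙z≈zy∙x)
open import Data.Fin using (Fin; suc)
open import Data.List using (List; _∷_; _++_; [_]; map)
open import Data.List.Properties
  using (map-++; ++-assoc; ++-identityʳ; ∷-injective; ++-conicalˡ; ++-conicalʳ)
open import Data.List.Membership.Propositional using (_∈_; _∉_)
open import Data.List.Membership.Propositional.Properties using (∈-++⁻; ∈-++⁺ˡ; ∈-++⁺ʳ)
open import Data.List.Relation.Binary.Subset.Propositional using (_⊆_)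
open import Data.List.Relation.Binary.Subset.Propositional.Properties using (∷⁺ʳ)
open import Data.List.Relation.Unary.Any using (here; there)
open import Data.List.Relation.Unary.All using (tail) renaming (lookup to All-lookup)
open import Data.List.Relation.Unary.All.Properties using (++⁺; ++⁻ˡ; ++⁻ʳ)
open import Data.List.Relation.Unary.AllPairs using ([]; _∷_)
open import Data.List.Relation.Unary.Unique.Propositional using (Unique)
open import Data.Product using (∃; ∃₂; _×_; _,_; proj₁; proj₂)
open import Data.Sum using (_⊎_; inj₁; inj₂)
open import Data.Empty using (⊥; ⊥-elim)
open import Function using (_∘_; id)
open import Relation.Nullary using (yes; no)
open import Relation.Binary.PropositionalEquality
  using (_≡_; _≢_; _≗_; refl; sym; trans; cong; cong₂; subst)

variable
  m n k k₁ k₂ j : ℕ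
  x y z : Var
  e e₁ e₂ u : Expr

module _ {X : Set} where

  ++-split : ∀ (xs ys ls rs : List X) {z} → xs ++ ys ≡ ls ++ z ∷ rs →
             (∃ λ ms → xs ≡ ls ++ z ∷ ms × rs ≡ ms ++ ys) ⊎
             (∃ λ ms → ys ≡ ms ++ z ∷ rs × ls ≡ xs ++ ms)
  ++-split []       ys ls       rs eq = inj₂ (ls , eq , refl)
  ++-split (x ∷ xs) ys []       rs eq with ∷-injective eq
  ... | refl , refl = inj₁ (xs , refl , refl)
  ++-split (x ∷ xs) ys (l ∷ ls) rs eq with ∷-injective eq
  ... | refl , eq′ with ++-split xs ys ls rs eq′
  ... | inj₁ (ms , p , q) = inj₁ (ms , cong (x ∷_) p , q)
  ... | inj₂ (ms , p , q) = inj₂ (ms , p , cong (x ∷_) q)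

  [x]≡ls++y∷rs : ∀ {x y : X} ls {rs} → [ x ] ≡ ls ++ y ∷ rs → ls ≡ [] × x ≡ y × rs ≡ []
  [x]≡ls++y∷rs []          refl = refl , refl , refl
  [x]≡ls++y∷rs (_ ∷ [])    ()
  [x]≡ls++y∷rs (_ ∷ _ ∷ _) ()

  ++-assoc₃ : ∀ (ws xs ys zs : List X) → (ws ++ xs ++ ys) ++ zs ≡ ws ++ xs ++ ys ++ zs
  ++-assoc₃ ws xs ys zs = trans (++-assoc ws (xs ++ ys) zs) (cong (ws ++_) (++-assoc xs ys zs))

  ++-assoc-middle : ∀ (vs ws xs ys zs : List X) →
                    vs ++ (ws ++ xs ++ ys) ++ zs ≡ (vs ++ ws) ++ xs ++ ys ++ zs
  ++-assoc-middle vs ws xs ys zs = trans (cong (vs ++_) (++-assoc₃ ws xs ys zs)) (sym (++-assoc vs ws _))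

  map-++₃ : ∀ {Y : Set} (f : X → Y) (xs ys zs : List X) →
            map f (xs ++ ys ++ zs) ≡ map f xs ++ map f ys ++ map f zs
  map-++₃ f xs ys zs = trans (map-++ f xs _) (cong (map f xs ++_) (map-++ f ys zs))

  Unique-++-disjoint : ∀ xs {ys} {z : X} → Unique (xs ++ ys) → z ∈ xs → z ∈ ys → ⊥
  Unique-++-disjoint (x ∷ xs) (x∉ ∷ _) (here refl) z∈ys = All-lookup x∉ (∈-++⁺ʳ xs z∈ys) refl
  Unique-++-disjoint (x ∷ xs) (_ ∷ u)  (there z∈xs) z∈ys = Unique-++-disjoint xs u z∈xs z∈ys

  Unique-++⁻ʳ : ∀ xs {ys : List X} → Unique (xs ++ ys) → Unique ys
  Unique-++⁻ʳ []       u       = u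
  Unique-++⁻ʳ (_ ∷ xs) (_ ∷ u) = Unique-++⁻ʳ xs u

  Unique-delete : ∀ xs {y : X} {ys} → Unique (xs ++ y ∷ ys) → Unique (xs ++ ys)
  Unique-delete []       (_ ∷ u)  = u
  Unique-delete (x ∷ xs) (x∉ ∷ u) = ++⁺ (++⁻ˡ xs x∉) (tail (++⁻ʳ xs x∉)) ∷ Unique-delete xs u

var-[/]-hit : ∀ u x → [ u / x ] var x ≡ u
var-[/]-hit u x with x ≟ x
... | yes _  = refl
... | no x≢x = ⊥-elim (x≢x refl)

lam-[/]-miss : x ≢ y → [ u / x ] lam y e ≡ lam y ([ u / x ] e)
lam-[/]-miss {x = x} {y = y} x≢y with x ≟ y
... | yes x≡y = ⊥-elim (x≢y x≡y)
... | no _    = refl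

match-[/]-miss : x ≢ y → x ≢ z → [ u / x ] match e y z e₁ ≡ match ([ u / x ] e) y z ([ u / x ] e₁)
match-[/]-miss {x = x} {y = y} {z = z} x≢y x≢z with x ≟ y | x ≟ z
... | yes x≡y | _       = ⊥-elim (x≢y x≡y)
... | no _    | yes x≡z = ⊥-elim (x≢z x≡z)
... | no _    | no _    = refl

match-[/]-scrutinee : (x ≢ y → x ≢ z → [ u / x ] e₁ ≡ e₁) →
                      [ u / x ] match e y z e₁ ≡ match ([ u / x ] e) y z e₁
match-[/]-scrutinee {x = x} {y = y} {z = z} fresh with x ≟ y | x ≟ z
... | yes _   | _       = refl
... | no _    | yes _   = refl
... | no x≢y  | no x≢z  = cong (match _ y z) (fresh x≢y x≢z)

scoped-⊆ : ∀ {Γ Γ′} → Scoped Γ e → Γ ⊆ Γ′ → Scoped Γ′ e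
scoped-⊆ (s-var x∈)    h = s-var (h x∈)
scoped-⊆ (s-pair s t)  h = s-pair (scoped-⊆ s h) (scoped-⊆ t h)
scoped-⊆ (s-match s t) h = s-match (scoped-⊆ s h) (scoped-⊆ t (∷⁺ʳ _ (∷⁺ʳ _ h)))
scoped-⊆ (s-lam s)     h = s-lam (scoped-⊆ s (∷⁺ʳ _ h))
scoped-⊆ (s-app s t)   h = s-app (scoped-⊆ s h) (scoped-⊆ t h)

[/]-fresh : ∀ {Γ} → Scoped Γ e → x ∉ Γ → [ u / x ] e ≡ e
[/]-fresh {x = x} (s-var {z} z∈) x∉ with x ≟ z
... | yes refl = ⊥-elim (x∉ z∈)
... | no _     = refl
[/]-fresh (s-pair s t) x∉ = cong₂ pair ([/]-fresh s x∉) ([/]-fresh t x∉)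
[/]-fresh {x = x} (s-match {x = y} {y = z} s t) x∉ with x ≟ y | x ≟ z
... | yes _   | _      = cong (λ e → match e y z _) ([/]-fresh s x∉)
... | no _    | yes _  = cong (λ e → match e y z _) ([/]-fresh s x∉)
... | no x≢y  | no x≢z = cong₂ (λ e e₁ → match e y z e₁) ([/]-fresh s x∉) ([/]-fresh t x∉′)
  where
  x∉′ : x ∉ y ∷ z ∷ _
  x∉′ (here x≡y)         = x≢y x≡y
  x∉′ (there (here x≡z)) = x≢z x≡z
  x∉′ (there (there x∈)) = x∉ x∈
[/]-fresh {x = x} (s-lam {y} s) x∉ with x ≟ y
... | yes _  = refl
... | no x≢y = cong (lam y) ([/]-fresh s λ { (here x≡y) → x≢y x≡y ; (there x∈) → x∉ x∈ })
[/]-fresh (s-app s t) x∉ = cong₂ app ([/]-fresh s x∉) ([/]-fresh t x∉)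

data Ty⁺ (n : ℕ) : Set where
  ι    : Ty⁺ n
  tvar : Fin n → Ty⁺ n
  _•_  : Ty⁺ n → Ty⁺ n → Ty⁺ n
  _⧵_  : Ty⁺ n → Ty⁺ n → Ty⁺ n
  _↠_  : Ty⁺ n → Ty⁺ n → Ty⁺ n
  all  : Ty⁺ (suc n) → Ty⁺ n

ren : ∀ {m n} → (Fin m → Fin n) → Ty⁺ m → Ty⁺ n
ren ρ ι        = ι
ren ρ (tvar i) = tvar (ρ i)
ren ρ (A • B)  = ren ρ A • ren ρ B
ren ρ (A ⧵ B)  = ren ρ A ⧵ ren ρ B
ren ρ (A ↠ B)  = ren ρ A ↠ ren ρ B
ren ρ (all A)  = all (ren (ext ρ) A)

wk : ∀ {n} → Ty⁺ n → Ty⁺ (suc n)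
wk = ren suc

exts⁺ : ∀ {m n} → (Fin m → Ty⁺ n) → Fin (suc m) → Ty⁺ (suc n)
exts⁺ σ zero    = tvar zero
exts⁺ σ (suc i) = wk (σ i)

sub : ∀ {m n} → (Fin m → Ty⁺ n) → Ty⁺ m → Ty⁺ n
sub σ ι        = ι
sub σ (tvar i) = σ i
sub σ (A • B)  = sub σ A • sub σ B
sub σ (A ⧵ B)  = sub σ A ⧵ sub σ B
sub σ (A ↠ B)  = sub σ A ↠ sub σ B
sub σ (all A)  = all (sub (exts⁺ σ) A)

single : ∀ {n} → Ty⁺ n → Fin (suc n) → Ty⁺ n
single B zero    = B
single B (suc i) = tvar i

_[_]⁺ : ∀ {n} → Ty⁺ (suc n) → Ty⁺ n → Ty⁺ n
A [ B ]⁺ = sub (single B) A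

ext-cong : ∀ {m n} {ρ ρ′ : Fin m → Fin n} → ρ ≗ ρ′ → ext ρ ≗ ext ρ′
ext-cong h zero    = refl
ext-cong h (suc i) = cong suc (h i)

ren-cong : ∀ {m n} {ρ ρ′ : Fin m → Fin n} → ρ ≗ ρ′ → ren ρ ≗ ren ρ′
ren-cong h ι        = refl
ren-cong h (tvar i) = cong tvar (h i)
ren-cong h (A • B)  = cong₂ _•_ (ren-cong h A) (ren-cong h B)
ren-cong h (A ⧵ B)  = cong₂ _⧵_ (ren-cong h A) (ren-cong h B)
ren-cong h (A ↠ B)  = cong₂ _↠_ (ren-cong h A) (ren-cong h B)
ren-cong h (all A)  = cong all (ren-cong (ext-cong h) A)

exts⁺-cong : ∀ {m n} {σ σ′ : Fin m → Ty⁺ n} → σ ≗ σ′ → exts⁺ σ ≗ exts⁺ σ′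
exts⁺-cong h zero    = refl
exts⁺-cong h (suc i) = cong wk (h i)

sub-cong : ∀ {m n} {σ σ′ : Fin m → Ty⁺ n} → σ ≗ σ′ → sub σ ≗ sub σ′
sub-cong h ι        = refl
sub-cong h (tvar i) = h i
sub-cong h (A • B)  = cong₂ _•_ (sub-cong h A) (sub-cong h B)
sub-cong h (A ⧵ B)  = cong₂ _⧵_ (sub-cong h A) (sub-cong h B)
sub-cong h (A ↠ B)  = cong₂ _↠_ (sub-cong h A) (sub-cong h B)
sub-cong h (all A)  = cong all (sub-cong (exts⁺-cong h) A)

ren-ren : ∀ {l m n} (ρ : Fin m → Fin n) (ρ′ : Fin l → Fin m) →
          ren ρ ∘ ren ρ′ ≗ ren (ρ ∘ ρ′)
ren-ren ρ ρ′ ι        = refl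
ren-ren ρ ρ′ (tvar i) = refl
ren-ren ρ ρ′ (A • B)  = cong₂ _•_ (ren-ren ρ ρ′ A) (ren-ren ρ ρ′ B)
ren-ren ρ ρ′ (A ⧵ B)  = cong₂ _⧵_ (ren-ren ρ ρ′ A) (ren-ren ρ ρ′ B)
ren-ren ρ ρ′ (A ↠ B)  = cong₂ _↠_ (ren-ren ρ ρ′ A) (ren-ren ρ ρ′ B)
ren-ren ρ ρ′ (all A)  =
  cong all (trans (ren-ren (ext ρ) (ext ρ′) A) (ren-cong (λ { zero → refl ; (suc i) → refl }) A))

sub-ren : ∀ {l m n} (σ : Fin m → Ty⁺ n) (ρ : Fin l → Fin m) →
          sub σ ∘ ren ρ ≗ sub (σ ∘ ρ)
sub-ren σ ρ ι        = refl
sub-ren σ ρ (tvar i) = refl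
sub-ren σ ρ (A • B)  = cong₂ _•_ (sub-ren σ ρ A) (sub-ren σ ρ B)
sub-ren σ ρ (A ⧵ B)  = cong₂ _⧵_ (sub-ren σ ρ A) (sub-ren σ ρ B)
sub-ren σ ρ (A ↠ B)  = cong₂ _↠_ (sub-ren σ ρ A) (sub-ren σ ρ B)
sub-ren σ ρ (all A)  =
  cong all (trans (sub-ren (exts⁺ σ) (ext ρ) A) (sub-cong (λ { zero → refl ; (suc i) → refl }) A))

ren-sub : ∀ {l m n} (ρ : Fin m → Fin n) (σ : Fin l → Ty⁺ m) →
          ren ρ ∘ sub σ ≗ sub (ren ρ ∘ σ)
ren-sub ρ σ ι        = refl
ren-sub ρ σ (tvar i) = refl
ren-sub ρ σ (A • B)  = cong₂ _•_ (ren-sub ρ σ A) (ren-sub ρ σ B)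
ren-sub ρ σ (A ⧵ B)  = cong₂ _⧵_ (ren-sub ρ σ A) (ren-sub ρ σ B)
ren-sub ρ σ (A ↠ B)  = cong₂ _↠_ (ren-sub ρ σ A) (ren-sub ρ σ B)
ren-sub ρ σ (all A)  = cong all (trans (ren-sub (ext ρ) (exts⁺ σ) A) (sub-cong commute A))
  where
  commute : ren (ext ρ) ∘ exts⁺ σ ≗ exts⁺ (ren ρ ∘ σ)
  commute zero    = refl
  commute (suc i) = trans (ren-ren (ext ρ) suc (σ i)) (sym (ren-ren suc ρ (σ i)))

sub-sub : ∀ {l m n} (τ : Fin m → Ty⁺ n) (σ : Fin l → Ty⁺ m) →
          sub τ ∘ sub σ ≗ sub (sub τ ∘ σ)
sub-sub τ σ ι        = refl
sub-sub τ σ (tvar i) = refl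
sub-sub τ σ (A • B)  = cong₂ _•_ (sub-sub τ σ A) (sub-sub τ σ B)
sub-sub τ σ (A ⧵ B)  = cong₂ _⧵_ (sub-sub τ σ A) (sub-sub τ σ B)
sub-sub τ σ (A ↠ B)  = cong₂ _↠_ (sub-sub τ σ A) (sub-sub τ σ B)
sub-sub τ σ (all A)  = cong all (trans (sub-sub (exts⁺ τ) (exts⁺ σ) A) (sub-cong commute A))
  where
  commute : sub (exts⁺ τ) ∘ exts⁺ σ ≗ exts⁺ (sub τ ∘ σ)
  commute zero    = refl
  commute (suc i) = trans (sub-ren (exts⁺ τ) suc (σ i)) (sym (ren-sub suc τ (σ i)))

sub-tvar : ∀ {n} → sub {n} tvar ≗ id
sub-tvar ι        = refl
sub-tvar (tvar i) = refl
sub-tvar (A • B)  = cong₂ _•_ (sub-tvar A) (sub-tvar B)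
sub-tvar (A ⧵ B)  = cong₂ _⧵_ (sub-tvar A) (sub-tvar B)
sub-tvar (A ↠ B)  = cong₂ _↠_ (sub-tvar A) (sub-tvar B)
sub-tvar (all A)  = cong all (trans (sub-cong (λ { zero → refl ; (suc i) → refl }) A) (sub-tvar A))

ren≗sub : ∀ {m n} (ρ : Fin m → Fin n) → ren ρ ≗ sub (tvar ∘ ρ)
ren≗sub ρ ι        = refl
ren≗sub ρ (tvar i) = refl
ren≗sub ρ (A • B)  = cong₂ _•_ (ren≗sub ρ A) (ren≗sub ρ B)
ren≗sub ρ (A ⧵ B)  = cong₂ _⧵_ (ren≗sub ρ A) (ren≗sub ρ B)
ren≗sub ρ (A ↠ B)  = cong₂ _↠_ (ren≗sub ρ A) (ren≗sub ρ B)
ren≗sub ρ (all A)  =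
  cong all (trans (ren≗sub (ext ρ) A) (sub-cong (λ { zero → refl ; (suc i) → refl }) A))

wk-[]⁺ : ∀ {n} (A B : Ty⁺ n) → wk A [ B ]⁺ ≡ A
wk-[]⁺ A B = trans (sub-ren (single B) suc A) (sub-tvar A)

sub-exts⁺-wk : ∀ {m n} (σ : Fin m → Ty⁺ n) (A : Ty⁺ m) → sub (exts⁺ σ) (wk A) ≡ wk (sub σ A)
sub-exts⁺-wk σ A = trans (sub-ren (exts⁺ σ) suc A) (sym (ren-sub suc σ A))

sub-[]⁺ : ∀ {m n} (σ : Fin m → Ty⁺ n) (A : Ty⁺ (suc m)) (B : Ty⁺ m) →
          sub σ (A [ B ]⁺) ≡ sub (exts⁺ σ) A [ sub σ B ]⁺
sub-[]⁺ σ A B =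
  trans (sub-sub σ (single B) A) (trans (sub-cong commute A) (sym (sub-sub (single (sub σ B)) (exts⁺ σ) A)))
  where
  commute : sub σ ∘ single B ≗ sub (single (sub σ B)) ∘ exts⁺ σ
  commute zero    = refl
  commute (suc i) = sym (wk-[]⁺ (σ i) (sub σ B))

data Entry (n : ℕ) : Set where
  decl  : Var → Ty⁺ n → Entry n
  const : Expr → Entry n

Cx⁺ : ℕ → Set
Cx⁺ n = List (Entry n)

names : ∀ {n} → Cx⁺ n → List Var
names []             = []
names (decl x A ∷ Ω) = x ∷ names Ω
names (const u ∷ Ω)  = names Ω

Distinct⁺ : ∀ {n} → Cx⁺ n → Set
Distinct⁺ Ω = Unique (names Ω)

Ground : ∀ {n} → Cx⁺ n → Set
Ground Ω = names Ω ≡ []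

mapTy : ∀ {m n} → (Ty⁺ m → Ty⁺ n) → Cx⁺ m → Cx⁺ n
mapTy f = map λ { (decl x A) → decl x (f A) ; (const u) → const u }

wkCx⁺ : ∀ {n} → Cx⁺ n → Cx⁺ (suc n)
wkCx⁺ = mapTy wk

mapTy-++ : ∀ {m n} (f : Ty⁺ m → Ty⁺ n) (Ω₁ Ω₂ : Cx⁺ m) → mapTy f (Ω₁ ++ Ω₂) ≡ mapTy f Ω₁ ++ mapTy f Ω₂
mapTy-++ f = map-++ _

mapTy-∘ : ∀ {l m n} (f : Ty⁺ m → Ty⁺ n) (g : Ty⁺ l → Ty⁺ m) → mapTy f ∘ mapTy g ≗ mapTy (f ∘ g)
mapTy-∘ f g []             = refl
mapTy-∘ f g (decl x A ∷ Ω) = cong (_ ∷_) (mapTy-∘ f g Ω)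
mapTy-∘ f g (const u ∷ Ω)  = cong (_ ∷_) (mapTy-∘ f g Ω)

mapTy-cong : ∀ {m n} {f g : Ty⁺ m → Ty⁺ n} → f ≗ g → mapTy f ≗ mapTy g
mapTy-cong h []             = refl
mapTy-cong h (decl x A ∷ Ω) = cong₂ _∷_ (cong (decl x) (h A)) (mapTy-cong h Ω)
mapTy-cong h (const u ∷ Ω)  = cong (_ ∷_) (mapTy-cong h Ω)

mapTy-id : ∀ {n} (Ω : Cx⁺ n) → mapTy id Ω ≡ Ω
mapTy-id []             = refl
mapTy-id (decl x A ∷ Ω) = cong (_ ∷_) (mapTy-id Ω)
mapTy-id (const u ∷ Ω)  = cong (_ ∷_) (mapTy-id Ω)

names-++ : ∀ {n} (Ω₁ Ω₂ : Cx⁺ n) → names (Ω₁ ++ Ω₂) ≡ names Ω₁ ++ names Ω₂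
names-++ []              Ω₂ = refl
names-++ (decl x A ∷ Ω₁) Ω₂ = cong (x ∷_) (names-++ Ω₁ Ω₂)
names-++ (const u ∷ Ω₁)  Ω₂ = names-++ Ω₁ Ω₂

names-mapTy : ∀ {m n} (f : Ty⁺ m → Ty⁺ n) (Ω : Cx⁺ m) → names (mapTy f Ω) ≡ names Ω
names-mapTy f []             = refl
names-mapTy f (decl x A ∷ Ω) = cong (x ∷_) (names-mapTy f Ω)
names-mapTy f (const u ∷ Ω)  = names-mapTy f Ω

module _ {n : ℕ} where

  ∈-names-++⁻ : ∀ (Ω₁ Ω₂ : Cx⁺ n) {z} → z ∈ names (Ω₁ ++ Ω₂) → z ∈ names Ω₁ ⊎ z ∈ names Ω₂
  ∈-names-++⁻ Ω₁ Ω₂ z∈ = ∈-++⁻ (names Ω₁) (subst (_ ∈_) (names-++ Ω₁ Ω₂) z∈)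

  ∈-names-++⁺ˡ : ∀ (Ω₁ Ω₂ : Cx⁺ n) {z} → z ∈ names Ω₁ → z ∈ names (Ω₁ ++ Ω₂)
  ∈-names-++⁺ˡ Ω₁ Ω₂ z∈ = subst (_ ∈_) (sym (names-++ Ω₁ Ω₂)) (∈-++⁺ˡ z∈)

  ∈-names-++⁺ʳ : ∀ (Ω₁ Ω₂ : Cx⁺ n) {z} → z ∈ names Ω₂ → z ∈ names (Ω₁ ++ Ω₂)
  ∈-names-++⁺ʳ Ω₁ Ω₂ z∈ = subst (_ ∈_) (sym (names-++ Ω₁ Ω₂)) (∈-++⁺ʳ (names Ω₁) z∈)

  ∈-names-focus : ∀ (ΩL ΩR : Cx⁺ n) {x A} → x ∈ names (ΩL ++ decl x A ∷ ΩR)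
  ∈-names-focus ΩL ΩR = ∈-names-++⁺ʳ ΩL _ (here refl)

  ground-++⁻ : ∀ (Ω₁ Ω₂ : Cx⁺ n) → Ground (Ω₁ ++ Ω₂) → Ground Ω₁ × Ground Ω₂
  ground-++⁻ Ω₁ Ω₂ g = ++-conicalˡ _ _ g′ , ++-conicalʳ (names Ω₁) _ g′
    where
    g′ : names Ω₁ ++ names Ω₂ ≡ []
    g′ = trans (sym (names-++ Ω₁ Ω₂)) g

  distinct-disjoint : ∀ (Ω₁ Ω₂ : Cx⁺ n) {z} → Distinct⁺ (Ω₁ ++ Ω₂) → z ∈ names Ω₁ → z ∈ names Ω₂ → ⊥
  distinct-disjoint Ω₁ Ω₂ d = Unique-++-disjoint (names Ω₁) (subst Unique (names-++ Ω₁ Ω₂) d)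

  distinct-++⁻ʳ : ∀ (Ω₁ Ω₂ : Cx⁺ n) → Distinct⁺ (Ω₁ ++ Ω₂) → Distinct⁺ Ω₂
  distinct-++⁻ʳ Ω₁ Ω₂ d = Unique-++⁻ʳ (names Ω₁) (subst Unique (names-++ Ω₁ Ω₂) d)

  ∈-names-binders⁻ : ∀ (ΩL ΩR : Cx⁺ n) {x y A B} →
                     names (ΩL ++ decl x A ∷ decl y B ∷ ΩR) ⊆ x ∷ y ∷ names ΩL ++ names ΩR
  ∈-names-binders⁻ ΩL ΩR w∈ with ∈-names-++⁻ ΩL _ w∈
  ... | inj₁ w∈ΩL                 = there (there (∈-++⁺ˡ w∈ΩL))
  ... | inj₂ (here refl)          = here refl
  ... | inj₂ (there (here refl))  = there (here refl)
  ... | inj₂ (there (there w∈ΩR)) = there (there (∈-++⁺ʳ (names ΩL) w∈ΩR))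

  distinct-plug : ∀ {Ω Ω′ : Cx⁺ n} ΩL Δ ΩR {x A} → Ground Δ →
                  Ω ≡ ΩL ++ decl x A ∷ ΩR → Ω′ ≡ ΩL ++ Δ ++ ΩR → Distinct⁺ Ω → Distinct⁺ Ω′
  distinct-plug ΩL Δ ΩR g refl refl d =
    subst Unique (sym names-plugged) (Unique-delete (names ΩL) (subst Unique (names-++ ΩL _) d))
    where
    names-plugged : names (ΩL ++ Δ ++ ΩR) ≡ names ΩL ++ names ΩR
    names-plugged =
      trans (names-++ ΩL _) (cong (names ΩL ++_) (trans (names-++ Δ ΩR) (cong (_++ names ΩR) g)))

distinct-mapTy : ∀ {m n} (f : Ty⁺ m → Ty⁺ n) Ω → Distinct⁺ Ω → Distinct⁺ (mapTy f Ω)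
distinct-mapTy f Ω = subst Unique (sym (names-mapTy f Ω))

distinct-mapTy-++ : ∀ {m n} (f : Ty⁺ m → Ty⁺ n) Ω₁ Ω₂ →
                    Distinct⁺ (Ω₁ ++ Ω₂) → Distinct⁺ (mapTy f Ω₁ ++ mapTy f Ω₂)
distinct-mapTy-++ f Ω₁ Ω₂ = subst Distinct⁺ (mapTy-++ f Ω₁ Ω₂) ∘ distinct-mapTy f (Ω₁ ++ Ω₂)

ground-mapTy : ∀ {m n} (f : Ty⁺ m → Ty⁺ n) Ω → Ground Ω → Ground (mapTy f Ω)
ground-mapTy f Ω = trans (names-mapTy f Ω)

variable
  A B C D : Ty⁺ n
  Ω Ω₁ Ω₂ ΩL ΩR Δ : Cx⁺ n

-- k is the size of the derivation, counting every rule but hyp and cst. The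
-- premises of ⧵E come function first, but its sizes, like its context, run
-- argument first.
infix 3 _∣_⊢_∶_⟨_⟩
data _∣_⊢_∶_⟨_⟩ (n : ℕ) : Cx⁺ n → Expr → Ty⁺ n → ℕ → Set where
  hyp : n ∣ [ decl x A ] ⊢ var x ∶ A ⟨ 0 ⟩
  cst : Closed u → Value u → n ∣ [ const u ] ⊢ u ∶ ι ⟨ 0 ⟩
  ↠I  : Distinct⁺ (Ω ++ [ decl x A ]) →
        n ∣ Ω ++ [ decl x A ] ⊢ e ∶ B ⟨ k ⟩ →
        n ∣ Ω ⊢ lam x e ∶ A ↠ B ⟨ suc k ⟩
  ↠E  : Distinct⁺ (Ω₁ ++ Ω₂) →
        n ∣ Ω₁ ⊢ e₁ ∶ A ↠ B ⟨ k₁ ⟩ → n ∣ Ω₂ ⊢ e₂ ∶ A ⟨ k₂ ⟩ →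
        n ∣ Ω₁ ++ Ω₂ ⊢ app e₁ e₂ ∶ B ⟨ suc (k₁ + k₂) ⟩
  ⧵I  : Distinct⁺ (decl x A ∷ Ω) →
        n ∣ decl x A ∷ Ω ⊢ e ∶ B ⟨ k ⟩ →
        n ∣ Ω ⊢ lam x e ∶ A ⧵ B ⟨ suc k ⟩
  ⧵E  : Distinct⁺ (Ω₁ ++ Ω₂) →
        n ∣ Ω₂ ⊢ e₁ ∶ A ⧵ B ⟨ k₂ ⟩ → n ∣ Ω₁ ⊢ e₂ ∶ A ⟨ k₁ ⟩ →
        n ∣ Ω₁ ++ Ω₂ ⊢ app e₁ e₂ ∶ B ⟨ suc (k₁ + k₂) ⟩
  •I  : Distinct⁺ (Ω₁ ++ Ω₂) →
        n ∣ Ω₁ ⊢ e₁ ∶ A ⟨ k₁ ⟩ → n ∣ Ω₂ ⊢ e₂ ∶ B ⟨ k₂ ⟩ →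
        n ∣ Ω₁ ++ Ω₂ ⊢ pair e₁ e₂ ∶ A • B ⟨ suc (k₁ + k₂) ⟩
  •E  : Distinct⁺ (ΩL ++ Ω ++ ΩR) →
        Distinct⁺ (ΩL ++ decl x A ∷ decl y B ∷ ΩR) →
        n ∣ Ω ⊢ e ∶ A • B ⟨ k₁ ⟩ →
        n ∣ ΩL ++ decl x A ∷ decl y B ∷ ΩR ⊢ e₁ ∶ C ⟨ k₂ ⟩ →
        n ∣ ΩL ++ Ω ++ ΩR ⊢ match e x y e₁ ∶ C ⟨ suc (k₁ + k₂) ⟩
  ∀I  : suc n ∣ wkCx⁺ Ω ⊢ e ∶ A ⟨ k ⟩ → n ∣ Ω ⊢ e ∶ all A ⟨ suc k ⟩
  ∀E  : (B : Ty⁺ n) → n ∣ Ω ⊢ e ∶ all A ⟨ k ⟩ → n ∣ Ω ⊢ e ∶ A [ B ]⁺ ⟨ suc k ⟩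

cast : ∀ {Ω′ e′ A′ k′} → Ω ≡ Ω′ → e ≡ e′ → A ≡ A′ → k ≡ k′ →
       n ∣ Ω ⊢ e ∶ A ⟨ k ⟩ → n ∣ Ω′ ⊢ e′ ∶ A′ ⟨ k′ ⟩
cast refl refl refl refl d = d

⊢-tsubst : (σ : Fin n → Ty⁺ m) → n ∣ Ω ⊢ e ∶ A ⟨ k ⟩ → m ∣ mapTy (sub σ) Ω ⊢ e ∶ sub σ A ⟨ k ⟩
⊢-tsubst σ hyp         = hyp
⊢-tsubst σ (cst c v)   = cst c v
⊢-tsubst σ (↠I {Ω = Ω} {x = x} {A = A} d ⊢e) =
  ↠I (distinct-mapTy-++ (sub σ) Ω [ decl x A ] d)
     (cast (mapTy-++ (sub σ) Ω _) refl refl refl (⊢-tsubst σ ⊢e))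
⊢-tsubst σ (⧵I {x = x} {A = A} {Ω = Ω} d ⊢e) = ⧵I (distinct-mapTy (sub σ) (decl x A ∷ Ω) d) (⊢-tsubst σ ⊢e)
⊢-tsubst σ (↠E {Ω₁ = Ω₁} {Ω₂ = Ω₂} d ⊢e₁ ⊢e₂) =
  cast (sym (mapTy-++ (sub σ) Ω₁ Ω₂)) refl refl refl
    (↠E (distinct-mapTy-++ (sub σ) Ω₁ Ω₂ d) (⊢-tsubst σ ⊢e₁) (⊢-tsubst σ ⊢e₂))
⊢-tsubst σ (⧵E {Ω₁ = Ω₁} {Ω₂ = Ω₂} d ⊢e₁ ⊢e₂) =
  cast (sym (mapTy-++ (sub σ) Ω₁ Ω₂)) refl refl refl
    (⧵E (distinct-mapTy-++ (sub σ) Ω₁ Ω₂ d) (⊢-tsubst σ ⊢e₁) (⊢-tsubst σ ⊢e₂))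
⊢-tsubst σ (•I {Ω₁ = Ω₁} {Ω₂ = Ω₂} d ⊢e₁ ⊢e₂) =
  cast (sym (mapTy-++ (sub σ) Ω₁ Ω₂)) refl refl refl
    (•I (distinct-mapTy-++ (sub σ) Ω₁ Ω₂ d) (⊢-tsubst σ ⊢e₁) (⊢-tsubst σ ⊢e₂))
⊢-tsubst σ (•E {ΩL = ΩL} {Ω = Ω} {ΩR = ΩR} {x = x} {A = A} {y = y} {B = B} d d′ ⊢e ⊢e₁) =
  cast (sym (map-++₃ _ ΩL Ω ΩR)) refl refl refl
    (•E (subst Distinct⁺ (map-++₃ _ ΩL Ω ΩR) (distinct-mapTy (sub σ) (ΩL ++ Ω ++ ΩR) d))
        (distinct-mapTy-++ (sub σ) ΩL (decl x A ∷ decl y B ∷ ΩR) d′)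
        (⊢-tsubst σ ⊢e)
        (cast (mapTy-++ (sub σ) ΩL _) refl refl refl (⊢-tsubst σ ⊢e₁)))
⊢-tsubst σ (∀I {Ω = Ω} ⊢e) = ∀I (cast commute refl refl refl (⊢-tsubst (exts⁺ σ) ⊢e))
  where
  commute : mapTy (sub (exts⁺ σ)) (wkCx⁺ Ω) ≡ wkCx⁺ (mapTy (sub σ) Ω)
  commute = trans (mapTy-∘ _ _ Ω) (trans (mapTy-cong (sub-exts⁺-wk σ) Ω) (sym (mapTy-∘ _ _ Ω)))
⊢-tsubst σ (∀E {A = A} B ⊢e) = cast refl refl (sym (sub-[]⁺ σ A B)) refl (∀E (sub σ B) (⊢-tsubst σ ⊢e))

⊢-weaken : n ∣ Ω ⊢ e ∶ A ⟨ k ⟩ → suc n ∣ wkCx⁺ Ω ⊢ e ∶ wk A ⟨ k ⟩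
⊢-weaken {Ω = Ω} {A = A} ⊢e =
  cast (mapTy-cong (sym ∘ ren≗sub suc) Ω) refl (sym (ren≗sub suc A)) refl (⊢-tsubst (λ i → tvar (suc i)) ⊢e)

⊢-instantiate : (B : Ty⁺ n) → suc n ∣ wkCx⁺ Ω ⊢ e ∶ A ⟨ k ⟩ → n ∣ Ω ⊢ e ∶ A [ B ]⁺ ⟨ k ⟩
⊢-instantiate {Ω = Ω} B ⊢e =
  cast (trans (mapTy-∘ _ _ Ω) (trans (mapTy-cong (λ A → wk-[]⁺ A B) Ω) (mapTy-id Ω))) refl refl refl
       (⊢-tsubst (single B) ⊢e)

⊢-scoped : n ∣ Ω ⊢ e ∶ A ⟨ k ⟩ → Scoped (names Ω) e
⊢-scoped hyp                   = s-var (here refl)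
⊢-scoped (cst c _)             = scoped-⊆ c λ ()
⊢-scoped (↠I {Ω = Ω} _ ⊢e)     = s-lam (scoped-⊆ (⊢-scoped ⊢e) h)
  where
  h : names (Ω ++ [ decl _ _ ]) ⊆ _ ∷ names Ω
  h w∈ with ∈-names-++⁻ Ω _ w∈
  ... | inj₁ w∈Ω         = there w∈Ω
  ... | inj₂ (here refl) = here refl
⊢-scoped (⧵I _ ⊢e)             = s-lam (⊢-scoped ⊢e)
⊢-scoped (↠E {Ω₁ = Ω₁} {Ω₂ = Ω₂} _ ⊢e₁ ⊢e₂) =
  s-app (scoped-⊆ (⊢-scoped ⊢e₁) (∈-names-++⁺ˡ Ω₁ Ω₂)) (scoped-⊆ (⊢-scoped ⊢e₂) (∈-names-++⁺ʳ Ω₁ Ω₂))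
⊢-scoped (⧵E {Ω₁ = Ω₁} {Ω₂ = Ω₂} _ ⊢e₁ ⊢e₂) =
  s-app (scoped-⊆ (⊢-scoped ⊢e₁) (∈-names-++⁺ʳ Ω₁ Ω₂)) (scoped-⊆ (⊢-scoped ⊢e₂) (∈-names-++⁺ˡ Ω₁ Ω₂))
⊢-scoped (•I {Ω₁ = Ω₁} {Ω₂ = Ω₂} _ ⊢e₁ ⊢e₂) =
  s-pair (scoped-⊆ (⊢-scoped ⊢e₁) (∈-names-++⁺ˡ Ω₁ Ω₂)) (scoped-⊆ (⊢-scoped ⊢e₂) (∈-names-++⁺ʳ Ω₁ Ω₂))
⊢-scoped (•E {ΩL = ΩL} {Ω = Ω} {ΩR = ΩR} _ _ ⊢e ⊢e₁) =
  s-match (scoped-⊆ (⊢-scoped ⊢e) (∈-names-++⁺ʳ ΩL _ ∘ ∈-names-++⁺ˡ Ω ΩR))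
          (scoped-⊆ (⊢-scoped ⊢e₁) (∷⁺ʳ _ (∷⁺ʳ _ frame) ∘ ∈-names-binders⁻ ΩL ΩR))
  where
  frame : names ΩL ++ names ΩR ⊆ names (ΩL ++ Ω ++ ΩR)
  frame w∈ with ∈-++⁻ (names ΩL) w∈
  ... | inj₁ w∈ΩL = ∈-names-++⁺ˡ ΩL _ w∈ΩL
  ... | inj₂ w∈ΩR = ∈-names-++⁺ʳ ΩL _ (∈-names-++⁺ʳ Ω ΩR w∈ΩR)
⊢-scoped (∀I {Ω = Ω} ⊢e)       = subst (λ Γ → Scoped Γ _) (names-mapTy wk Ω) (⊢-scoped ⊢e)
⊢-scoped (∀E _ ⊢e)             = ⊢-scoped ⊢e

⊢-[/]-fresh : x ∉ names Ω → n ∣ Ω ⊢ e ∶ A ⟨ k ⟩ → [ u / x ] e ≡ e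
⊢-[/]-fresh x∉ ⊢e = [/]-fresh (⊢-scoped ⊢e) x∉

⊢-match-[/]-body : x ≢ y → x ≢ z → x ∉ names Ω → n ∣ Ω ⊢ e ∶ A ⟨ k ⟩ →
                   [ u / x ] match e y z e₁ ≡ match e y z ([ u / x ] e₁)
⊢-match-[/]-body {y = y} {z = z} x≢y x≢z x∉Ω ⊢e =
  trans (match-[/]-miss x≢y x≢z) (cong (λ e → match e y z _) (⊢-[/]-fresh x∉Ω ⊢e))

data Adjacent (n : ℕ) (Ω : Cx⁺ n) (e₁ e₂ : Expr) (A B : Ty⁺ n) (k : ℕ) : Set where
  adjacent : ∀ {Ω₁ Ω₂ k₁ k₂} → Ω ≡ Ω₁ ++ Ω₂ → k ≡ k₁ + k₂ → Distinct⁺ (Ω₁ ++ Ω₂) →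
             n ∣ Ω₁ ⊢ e₁ ∶ A ⟨ k₁ ⟩ → n ∣ Ω₂ ⊢ e₂ ∶ B ⟨ k₂ ⟩ → Adjacent n Ω e₁ e₂ A B k

⊢-[/] : n ∣ Ω ⊢ e ∶ B ⟨ k ⟩ → Ω ≡ ΩL ++ decl x A ∷ ΩR →
        Ground Δ → n ∣ Δ ⊢ u ∶ A ⟨ j ⟩ →
        n ∣ ΩL ++ Δ ++ ΩR ⊢ [ u / x ] e ∶ B ⟨ k + j ⟩

⊢-[/]-adjacent : Ω₁ ++ Ω₂ ≡ ΩL ++ decl x A ∷ ΩR → Distinct⁺ (Ω₁ ++ Ω₂) →
                 n ∣ Ω₁ ⊢ e₁ ∶ B ⟨ k₁ ⟩ → n ∣ Ω₂ ⊢ e₂ ∶ C ⟨ k₂ ⟩ →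
                 Ground Δ → n ∣ Δ ⊢ u ∶ A ⟨ j ⟩ →
                 Adjacent n (ΩL ++ Δ ++ ΩR) ([ u / x ] e₁) ([ u / x ] e₂) B C (k₁ + k₂ + j)

⊢-[/]-match-left : ∀ ΩL M →
  Distinct⁺ ((ΩL ++ decl x A ∷ M) ++ Ω ++ ΩR) →
  Distinct⁺ ((ΩL ++ decl x A ∷ M) ++ decl y B ∷ decl z C ∷ ΩR) →
  n ∣ Ω ⊢ e ∶ B • C ⟨ k₁ ⟩ →
  n ∣ (ΩL ++ decl x A ∷ M) ++ decl y B ∷ decl z C ∷ ΩR ⊢ e₁ ∶ D ⟨ k₂ ⟩ →
  Ground Δ → n ∣ Δ ⊢ u ∶ A ⟨ j ⟩ →
  n ∣ ΩL ++ Δ ++ M ++ Ω ++ ΩR ⊢ [ u / x ] match e y z e₁ ∶ D ⟨ suc (k₁ + k₂) + j ⟩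

⊢-[/]-match-scrutinee : ∀ ΩL M M′ →
  Distinct⁺ (ΩL ++ (M ++ decl x A ∷ M′) ++ ΩR) →
  Distinct⁺ (ΩL ++ decl y B ∷ decl z C ∷ ΩR) →
  n ∣ M ++ decl x A ∷ M′ ⊢ e ∶ B • C ⟨ k₁ ⟩ →
  n ∣ ΩL ++ decl y B ∷ decl z C ∷ ΩR ⊢ e₁ ∶ D ⟨ k₂ ⟩ →
  Ground Δ → n ∣ Δ ⊢ u ∶ A ⟨ j ⟩ →
  n ∣ (ΩL ++ M) ++ Δ ++ M′ ++ ΩR ⊢ [ u / x ] match e y z e₁ ∶ D ⟨ suc (k₁ + k₂) + j ⟩

⊢-[/]-match-right : ∀ ΩL M′ ΩR →
  Distinct⁺ (ΩL ++ Ω ++ M′ ++ decl x A ∷ ΩR) →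
  Distinct⁺ (ΩL ++ decl y B ∷ decl z C ∷ M′ ++ decl x A ∷ ΩR) →
  n ∣ Ω ⊢ e ∶ B • C ⟨ k₁ ⟩ →
  n ∣ ΩL ++ decl y B ∷ decl z C ∷ M′ ++ decl x A ∷ ΩR ⊢ e₁ ∶ D ⟨ k₂ ⟩ →
  Ground Δ → n ∣ Δ ⊢ u ∶ A ⟨ j ⟩ →
  n ∣ (ΩL ++ Ω ++ M′) ++ Δ ++ ΩR ⊢ [ u / x ] match e y z e₁ ∶ D ⟨ suc (k₁ + k₂) + j ⟩

⊢-[/] {ΩL = ΩL} hyp eq g ⊢u with [x]≡ls++y∷rs ΩL eq
... | refl , refl , refl = cast (sym (++-identityʳ _)) (sym (var-[/]-hit _ _)) refl refl ⊢u
⊢-[/] {ΩL = ΩL} (cst _ _) eq g ⊢u with [x]≡ls++y∷rs ΩL eq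
... | _ , () , _
⊢-[/] {ΩL = ΩL} {x = x} {ΩR = ΩR} {Δ = Δ} (↠I {x = y} d ⊢e) refl g ⊢u =
  cast refl (sym (lam-[/]-miss x≢y)) refl refl
    (↠I (distinct-plug ΩL Δ (ΩR ++ _) g (++-assoc ΩL _ _) (++-assoc₃ ΩL Δ ΩR _) d)
        (cast (sym (++-assoc₃ ΩL Δ ΩR _)) refl refl refl (⊢-[/] ⊢e (++-assoc ΩL _ _) g ⊢u)))
  where
  x≢y : x ≢ y
  x≢y refl = distinct-disjoint (ΩL ++ _ ∷ ΩR) [ _ ] d (∈-names-focus ΩL ΩR) (here refl)
⊢-[/] {ΩL = ΩL} {x = x} {ΩR = ΩR} {Δ = Δ} (⧵I {x = y} {A = A} d ⊢e) refl g ⊢u =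
  cast refl (sym (lam-[/]-miss x≢y)) refl refl
    (⧵I (distinct-plug (decl y A ∷ ΩL) Δ ΩR g refl refl d) (⊢-[/] {ΩL = decl y A ∷ ΩL} ⊢e refl g ⊢u))
  where
  x≢y : x ≢ y
  x≢y refl = distinct-disjoint [ decl y A ] (ΩL ++ _ ∷ ΩR) d (here refl) (∈-names-focus ΩL ΩR)
⊢-[/] (↠E d ⊢e₁ ⊢e₂) eq g ⊢u with ⊢-[/]-adjacent eq d ⊢e₁ ⊢e₂ g ⊢u
... | adjacent split size d′ ⊢e₁′ ⊢e₂′ = cast (sym split) refl refl (cong suc (sym size)) (↠E d′ ⊢e₁′ ⊢e₂′)
⊢-[/] (⧵E d ⊢e₁ ⊢e₂) eq g ⊢u with ⊢-[/]-adjacent eq d ⊢e₂ ⊢e₁ g ⊢u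
... | adjacent split size d′ ⊢e₂′ ⊢e₁′ = cast (sym split) refl refl (cong suc (sym size)) (⧵E d′ ⊢e₁′ ⊢e₂′)
⊢-[/] (•I d ⊢e₁ ⊢e₂) eq g ⊢u with ⊢-[/]-adjacent eq d ⊢e₁ ⊢e₂ g ⊢u
... | adjacent split size d′ ⊢e₁′ ⊢e₂′ = cast (sym split) refl refl (cong suc (sym size)) (•I d′ ⊢e₁′ ⊢e₂′)
⊢-[/] {ΩL = ΓL} {ΩR = ΓR} (•E {ΩL = ΩL} {Ω = Ω} {ΩR = ΩR} d d′ ⊢e ⊢e₁) eq g ⊢u
  with ++-split ΩL (Ω ++ ΩR) ΓL ΓR eq
... | inj₁ (M , refl , refl) = ⊢-[/]-match-left ΓL M d d′ ⊢e ⊢e₁ g ⊢u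
... | inj₂ (M , eq′ , refl) with ++-split Ω ΩR M ΓR eq′
...   | inj₁ (M′ , refl , refl) = ⊢-[/]-match-scrutinee ΩL M M′ d d′ ⊢e ⊢e₁ g ⊢u
...   | inj₂ (M′ , refl , refl) = ⊢-[/]-match-right ΩL M′ ΓR d d′ ⊢e ⊢e₁ g ⊢u
⊢-[/] {ΩL = ΩL} {ΩR = ΩR} {Δ = Δ} (∀I ⊢e) refl g ⊢u =
  ∀I (cast (sym (map-++₃ _ ΩL Δ ΩR)) refl refl refl
          (⊢-[/] ⊢e (mapTy-++ wk ΩL _) (ground-mapTy wk Δ g) (⊢-weaken ⊢u)))
⊢-[/] (∀E B ⊢e) eq g ⊢u = ∀E B (⊢-[/] ⊢e eq g ⊢u)

⊢-[/]-adjacent {Ω₁ = Ω₁} {Ω₂ = Ω₂} {ΩL = ΩL} {x = x} {ΩR = ΩR} {k₁ = k₁} {k₂ = k₂} {Δ = Δ} {j = j}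
  eq d ⊢e₁ ⊢e₂ g ⊢u with ++-split Ω₁ Ω₂ ΩL ΩR eq
... | inj₁ (M , refl , refl) =
  adjacent (sym (++-assoc₃ ΩL Δ M Ω₂)) (xy∙z≈xz∙y k₁ k₂ j)
    (distinct-plug ΩL Δ (M ++ Ω₂) g (++-assoc ΩL _ Ω₂) (++-assoc₃ ΩL Δ M Ω₂) d)
    (⊢-[/] ⊢e₁ refl g ⊢u)
    (cast refl (sym (⊢-[/]-fresh x∉Ω₂ ⊢e₂)) refl refl ⊢e₂)
  where
  x∉Ω₂ : x ∉ names Ω₂
  x∉Ω₂ = distinct-disjoint (ΩL ++ _ ∷ M) Ω₂ d (∈-names-focus ΩL M)
... | inj₂ (M , refl , refl) =
  adjacent (++-assoc Ω₁ M (Δ ++ ΩR)) (+-assoc k₁ k₂ j)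
    (distinct-plug (Ω₁ ++ M) Δ ΩR g (sym (++-assoc Ω₁ M _)) (sym (++-assoc Ω₁ M _)) d)
    (cast refl (sym (⊢-[/]-fresh x∉Ω₁ ⊢e₁)) refl refl ⊢e₁)
    (⊢-[/] ⊢e₂ refl g ⊢u)
  where
  x∉Ω₁ : x ∉ names Ω₁
  x∉Ω₁ x∈ = distinct-disjoint Ω₁ (M ++ _ ∷ ΩR) d x∈ (∈-names-focus M ΩR)

⊢-[/]-match-left {x = x} {A = A} {Ω = Ω} {ΩR = ΩR} {y = y} {B = B} {z = z} {C = C} {k₁ = k₁} {k₂ = k₂}
                 {Δ = Δ} {j = j} ΩL M d d′ ⊢e ⊢e₁ g ⊢u =
  cast (++-assoc₃ ΩL Δ M (Ω ++ ΩR)) (sym (⊢-match-[/]-body x≢y x≢z x∉Ω ⊢e)) refl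
       (cong suc (sym (+-assoc k₁ k₂ j)))
    (•E (distinct-plug ΩL Δ (M ++ Ω ++ ΩR) g (++-assoc ΩL _ _) (++-assoc₃ ΩL Δ M _) d)
        (distinct-plug ΩL Δ (M ++ _) g (++-assoc ΩL _ _) (++-assoc₃ ΩL Δ M _) d′)
        ⊢e
        (cast (sym (++-assoc₃ ΩL Δ M _)) refl refl refl (⊢-[/] ⊢e₁ (++-assoc ΩL _ _) g ⊢u)))
  where
  x∈ : x ∈ names (ΩL ++ decl x A ∷ M)
  x∈ = ∈-names-focus ΩL M
  x≢y : x ≢ y
  x≢y refl = distinct-disjoint (ΩL ++ decl x A ∷ M) (decl y B ∷ decl z C ∷ ΩR) d′ x∈ (here refl)
  x≢z : x ≢ z
  x≢z refl = distinct-disjoint (ΩL ++ decl x A ∷ M) (decl y B ∷ decl z C ∷ ΩR) d′ x∈ (there (here refl))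
  x∉Ω : x ∉ names Ω
  x∉Ω = distinct-disjoint (ΩL ++ decl x A ∷ M) (Ω ++ ΩR) d x∈ ∘ ∈-names-++⁺ˡ Ω ΩR

⊢-[/]-match-scrutinee {x = x} {ΩR = ΩR} {y = y} {z = z} {k₁ = k₁} {e₁ = e₁} {k₂ = k₂}
                      {Δ = Δ} {u = u} {j = j}
  ΩL M M′ d d′ ⊢e ⊢e₁ g ⊢u =
  cast (++-assoc-middle ΩL M Δ M′ ΩR) (sym (match-[/]-scrutinee fresh)) refl (cong suc (xy∙z≈xz∙y k₁ j k₂))
    (•E (distinct-plug (ΩL ++ M) Δ (M′ ++ ΩR) g
                       (++-assoc-middle ΩL M [ _ ] M′ ΩR) (++-assoc-middle ΩL M Δ M′ ΩR) d)
        d′ (⊢-[/] ⊢e refl g ⊢u) ⊢e₁)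
  where
  x∈ : x ∈ names (M ++ _ ∷ M′)
  x∈ = ∈-names-focus M M′
  fresh : x ≢ y → x ≢ z → [ u / x ] e₁ ≡ e₁
  fresh x≢y x≢z = ⊢-[/]-fresh x∉ ⊢e₁
    where
    x∉ : x ∉ names (ΩL ++ decl y _ ∷ decl z _ ∷ ΩR)
    x∉ x∈′ with ∈-names-binders⁻ ΩL ΩR x∈′
    ... | here x≡y         = x≢y x≡y
    ... | there (here x≡z) = x≢z x≡z
    ... | there (there x∈ΩLΩR) with ∈-++⁻ (names ΩL) x∈ΩLΩR
    ...   | inj₁ x∈ΩL = distinct-disjoint ΩL _ d x∈ΩL (∈-names-++⁺ˡ (M ++ _ ∷ M′) ΩR x∈)
    ...   | inj₂ x∈ΩR = distinct-disjoint (M ++ _ ∷ M′) ΩR (distinct-++⁻ʳ ΩL _ d) x∈ x∈ΩR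

⊢-[/]-match-right {Ω = Ω} {x = x} {A = A} {y = y} {B = B} {z = z} {C = C} {k₁ = k₁} {k₂ = k₂}
                  {Δ = Δ} {j = j} ΩL M′ ΩR d d′ ⊢e ⊢e₁ g ⊢u =
  cast (sym (++-assoc₃ ΩL Ω M′ (Δ ++ ΩR))) (sym (⊢-match-[/]-body x≢y x≢z x∉Ω ⊢e)) refl
       (cong suc (sym (+-assoc k₁ k₂ j)))
    (•E (distinct-plug (ΩL ++ Ω ++ M′) Δ ΩR g (sym (++-assoc₃ ΩL Ω M′ _)) (sym (++-assoc₃ ΩL Ω M′ _)) d)
        (distinct-plug (ΩL ++ binders) Δ ΩR g (sym (++-assoc ΩL _ _)) (sym (++-assoc ΩL _ _)) d′)
        ⊢e
        (cast (++-assoc ΩL _ _) refl refl refl (⊢-[/] ⊢e₁ (sym (++-assoc ΩL _ _)) g ⊢u)))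
  where
  binders : Cx⁺ _
  binders = decl y B ∷ decl z C ∷ M′
  d′ʳ : Distinct⁺ ((ΩL ++ binders) ++ decl x A ∷ ΩR)
  d′ʳ = subst Distinct⁺ (sym (++-assoc ΩL _ _)) d′
  x≢y : x ≢ y
  x≢y refl = distinct-disjoint (ΩL ++ binders) (decl x A ∷ ΩR) d′ʳ (∈-names-focus ΩL _) (here refl)
  x≢z : x ≢ z
  x≢z refl =
    distinct-disjoint (ΩL ++ binders) (decl x A ∷ ΩR) d′ʳ (∈-names-++⁺ʳ ΩL _ (there (here refl))) (here refl)
  x∉Ω : x ∉ names Ω
  x∉Ω x∈Ω = distinct-disjoint Ω (M′ ++ decl x A ∷ ΩR) (distinct-++⁻ʳ ΩL _ d) x∈Ω (∈-names-focus M′ ΩR)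

data Canonical (n : ℕ) : Cx⁺ n → Expr → Ty⁺ n → ℕ → Set where
  ιI : Canonical n [ const u ] u ι 0
  ↠I : n ∣ Ω ++ [ decl x A ] ⊢ e ∶ B ⟨ k ⟩ → Canonical n Ω (lam x e) (A ↠ B) (suc k)
  ⧵I : n ∣ decl x A ∷ Ω ⊢ e ∶ B ⟨ k ⟩ → Canonical n Ω (lam x e) (A ⧵ B) (suc k)
  •I : n ∣ Ω₁ ⊢ e₁ ∶ A ⟨ k₁ ⟩ → n ∣ Ω₂ ⊢ e₂ ∶ B ⟨ k₂ ⟩ →
       Canonical n (Ω₁ ++ Ω₂) (pair e₁ e₂) (A • B) (suc (k₁ + k₂))
  ∀I : suc n ∣ wkCx⁺ Ω ⊢ u ∶ A ⟨ k ⟩ → Canonical n Ω u (all A) (suc k)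

HasCanonicalForm : ℕ → Set
HasCanonicalForm k = ∀ {n Ω u A} → Value u → n ∣ Ω ⊢ u ∶ A ⟨ k ⟩ → ∃ λ k′ → k′ ≤ k × Canonical n Ω u A k′

-- ⊢-instantiate preserves size, so ∀E is eliminated by recursion on size.
canonical-step : ∀ k → <-Rec HasCanonicalForm k → HasCanonicalForm k
canonical-step _ rec ()  hyp
canonical-step _ rec _   (cst _ _)    = _ , ≤-refl , ιI
canonical-step _ rec _   (↠I _ ⊢e)    = _ , ≤-refl , ↠I ⊢e
canonical-step _ rec _   (⧵I _ ⊢e)    = _ , ≤-refl , ⧵I ⊢e
canonical-step _ rec _   (•I _ ⊢e₁ ⊢e₂) = _ , ≤-refl , •I ⊢e₁ ⊢e₂
canonical-step _ rec _   (∀I ⊢u)      = _ , ≤-refl , ∀I ⊢u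
canonical-step _ rec ()  (↠E _ _ _)
canonical-step _ rec ()  (⧵E _ _ _)
canonical-step _ rec ()  (•E _ _ _ _)
canonical-step (suc k) rec v (∀E B ⊢u) with rec ≤-refl v ⊢u
... | suc k′ , k′<k , ∀I ⊢u′ with rec (m<n⇒m<1+n k′<k) v (⊢-instantiate B ⊢u′)
...   | k″ , k″≤k′ , c = k″ , ≤-trans k″≤k′ (<⇒≤ (m<n⇒m<1+n k′<k)) , c

canonical : Value u → n ∣ Ω ⊢ u ∶ A ⟨ k ⟩ → ∃ λ k′ → k′ ≤ k × Canonical n Ω u A k′
canonical {k = k} = <-rec HasCanonicalForm canonical-step k

value-ι : Value u → n ∣ Ω ⊢ u ∶ ι ⟨ k ⟩ → Ω ≡ [ const u ]
value-ι v ⊢u with canonical v ⊢u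
... | _ , _ , ιI = refl

value-ι•ι : Value u → n ∣ Ω ⊢ u ∶ ι • ι ⟨ k ⟩ →
            ∃₂ λ u₁ u₂ → u ≡ pair u₁ u₂ × Ω ≡ const u₁ ∷ const u₂ ∷ []
value-ι•ι v ⊢u with canonical v ⊢u | v
... | _ , _ , •I ⊢u₁ ⊢u₂ | v-pair v₁ v₂ with value-ι v₁ ⊢u₁ | value-ι v₂ ⊢u₂
... | refl | refl = _ , _ , refl , refl

value-↪ : Value u → u ↪ u
value-↪ v-lam          = ev-lam
value-↪ (v-pair v₁ v₂) = ev-pair (value-↪ v₁) (value-↪ v₂)

data Evaluates (n : ℕ) (Ω : Cx⁺ n) (e : Expr) (A : Ty⁺ n) (k : ℕ) : Set where
  evaluates : ∀ {u k′} → e ↪ u → Value u → k′ ≤ k → n ∣ Ω ⊢ u ∶ A ⟨ k′ ⟩ → Evaluates n Ω e A k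

Evaluable : ℕ → Set
Evaluable k = ∀ {n Ω e A} → Ground Ω → n ∣ Ω ⊢ e ∶ A ⟨ k ⟩ → Evaluates n Ω e A k

evaluate-reduct : ∀ {e′ k′} → <-Rec Evaluable k → k′ < k → Ground Ω → n ∣ Ω ⊢ e′ ∶ A ⟨ k′ ⟩ →
                  (∀ {u} → e′ ↪ u → e ↪ u) → Evaluates n Ω e A k
evaluate-reduct rec k′<k g ⊢e′ step with rec k′<k g ⊢e′
... | evaluates e′↪ v le ⊢v = evaluates (step e′↪) v (≤-trans le (<⇒≤ k′<k)) ⊢v

evaluate-•I : <-Rec Evaluable (suc (k₁ + k₂)) → Ground (Ω₁ ++ Ω₂) → Distinct⁺ (Ω₁ ++ Ω₂) →
              n ∣ Ω₁ ⊢ e₁ ∶ A ⟨ k₁ ⟩ → n ∣ Ω₂ ⊢ e₂ ∶ B ⟨ k₂ ⟩ →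
              Evaluates n (Ω₁ ++ Ω₂) (pair e₁ e₂) (A • B) (suc (k₁ + k₂))
evaluate-•I {k₁ = k₁} {k₂ = k₂} {Ω₁ = Ω₁} {Ω₂ = Ω₂} rec g d ⊢e₁ ⊢e₂ with ground-++⁻ Ω₁ Ω₂ g
... | g₁ , g₂ with rec (s≤s (m≤m+n k₁ k₂)) g₁ ⊢e₁ | rec (s≤s (m≤n+m k₂ k₁)) g₂ ⊢e₂
... | evaluates e₁↪ v₁ le₁ ⊢v₁ | evaluates e₂↪ v₂ le₂ ⊢v₂ =
  evaluates (ev-pair e₁↪ e₂↪) (v-pair v₁ v₂) (s≤s (+-mono-≤ le₁ le₂)) (•I d ⊢v₁ ⊢v₂)

evaluate-↠E : <-Rec Evaluable (suc (k₁ + k₂)) → Ground (Ω₁ ++ Ω₂) →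
              n ∣ Ω₁ ⊢ e₁ ∶ A ↠ B ⟨ k₁ ⟩ → n ∣ Ω₂ ⊢ e₂ ∶ A ⟨ k₂ ⟩ →
              Evaluates n (Ω₁ ++ Ω₂) (app e₁ e₂) B (suc (k₁ + k₂))
evaluate-↠E {k₁ = k₁} {k₂ = k₂} {Ω₁ = Ω₁} {Ω₂ = Ω₂} rec g ⊢e₁ ⊢e₂ with ground-++⁻ Ω₁ Ω₂ g
... | g₁ , g₂ with rec (s≤s (m≤m+n k₁ k₂)) g₁ ⊢e₁ | rec (s≤s (m≤n+m k₂ k₁)) g₂ ⊢e₂
... | evaluates e₁↪ v₁ le₁ ⊢v₁ | evaluates {k′ = a} e₂↪ _ le₂ ⊢v₂ with canonical v₁ ⊢v₁
... | _ , le , ↠I {k = kb} ⊢b =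
  evaluate-reduct rec smaller g
    (cast (cong (Ω₁ ++_) (++-identityʳ Ω₂)) refl refl refl (⊢-[/] ⊢b refl g₂ ⊢v₂))
    (ev-app e₁↪ e₂↪)
  where
  smaller : kb + a < suc (k₁ + k₂)
  smaller = m<n⇒m<1+n (+-mono-<-≤ (≤-trans le le₁) le₂)

evaluate-⧵E : <-Rec Evaluable (suc (k₁ + k₂)) → Ground (Ω₁ ++ Ω₂) →
              n ∣ Ω₂ ⊢ e₁ ∶ A ⧵ B ⟨ k₂ ⟩ → n ∣ Ω₁ ⊢ e₂ ∶ A ⟨ k₁ ⟩ →
              Evaluates n (Ω₁ ++ Ω₂) (app e₁ e₂) B (suc (k₁ + k₂))
evaluate-⧵E {k₁ = k₁} {k₂ = k₂} {Ω₁ = Ω₁} {Ω₂ = Ω₂} rec g ⊢e₁ ⊢e₂ with ground-++⁻ Ω₁ Ω₂ g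
... | g₁ , g₂ with rec (s≤s (m≤n+m k₂ k₁)) g₂ ⊢e₁ | rec (s≤s (m≤m+n k₁ k₂)) g₁ ⊢e₂
... | evaluates e₁↪ v₁ le₁ ⊢v₁ | evaluates {k′ = a} e₂↪ _ le₂ ⊢v₂ with canonical v₁ ⊢v₁
... | _ , le , ⧵I {k = kb} ⊢b =
  evaluate-reduct rec smaller g (⊢-[/] {ΩL = []} ⊢b refl g₁ ⊢v₂) (ev-app e₁↪ e₂↪)
  where
  smaller : kb + a < suc (k₁ + k₂)
  smaller = m<n⇒m<1+n (≤-trans (+-mono-<-≤ (≤-trans le le₁) le₂) (≤-reflexive (+-comm k₂ k₁)))

evaluate-•E : <-Rec Evaluable (suc (k₁ + k₂)) → Ground (ΩL ++ Ω ++ ΩR) →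
              n ∣ Ω ⊢ e ∶ A • B ⟨ k₁ ⟩ → n ∣ ΩL ++ decl x A ∷ decl y B ∷ ΩR ⊢ e₁ ∶ C ⟨ k₂ ⟩ →
              Evaluates n (ΩL ++ Ω ++ ΩR) (match e x y e₁) C (suc (k₁ + k₂))
evaluate-•E {k₁ = k₁} {k₂ = k₂} {ΩL = ΩL} {Ω = Ω} {ΩR = ΩR} {A = A} {x = x} rec g ⊢e ⊢e₁
  with ground-++⁻ ΩL (Ω ++ ΩR) g
... | _ , gΩΩR with ground-++⁻ Ω ΩR gΩΩR
... | gΩ , _ with rec (s≤s (m≤m+n k₁ k₂)) gΩ ⊢e
... | evaluates e↪ v le₁ ⊢v with canonical v ⊢v
... | _ , le , •I {Ω₁ = Ω₁} {k₁ = a₁} {Ω₂ = Ω₂} {k₂ = a₂} ⊢v₁ ⊢v₂ with ground-++⁻ Ω₁ Ω₂ gΩ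
... | g₁ , g₂ =
  evaluate-reduct rec smaller g
    (cast (cong (ΩL ++_) (sym (++-assoc Ω₁ Ω₂ ΩR))) refl refl refl
      (⊢-[/] (⊢-[/] ⊢e₁ (sym (++-assoc ΩL [ decl x A ] _)) g₂ ⊢v₂) (++-assoc ΩL [ decl x A ] _) g₁ ⊢v₁))
    (ev-match e↪)
  where
  smaller : k₂ + a₂ + a₁ < suc (k₁ + k₂)
  smaller = m<n⇒m<1+n (subst (_< k₁ + k₂) (sym (xy∙z≈zy∙x k₂ a₂ a₁)) (+-monoˡ-< k₂ (≤-trans le le₁)))

evaluate-step : ∀ k → <-Rec Evaluable k → Evaluable k
evaluate-step _ rec ()  hyp
evaluate-step _ rec _   (cst c v)          = evaluates (value-↪ v) v ≤-refl (cst c v)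
evaluate-step _ rec _   ⊢λ@(↠I _ _)        = evaluates ev-lam v-lam ≤-refl ⊢λ
evaluate-step _ rec _   ⊢λ@(⧵I _ _)        = evaluates ev-lam v-lam ≤-refl ⊢λ
evaluate-step _ rec g   (↠E _ ⊢e₁ ⊢e₂)     = evaluate-↠E rec g ⊢e₁ ⊢e₂
evaluate-step _ rec g   (⧵E _ ⊢e₁ ⊢e₂)     = evaluate-⧵E rec g ⊢e₁ ⊢e₂
evaluate-step _ rec g   (•E _ _ ⊢e ⊢e₁)    = evaluate-•E rec g ⊢e ⊢e₁
evaluate-step _ rec g   (•I d ⊢e₁ ⊢e₂)     = evaluate-•I rec g d ⊢e₁ ⊢e₂
evaluate-step (suc k) rec g (∀I {Ω = Ω} ⊢e) with rec ≤-refl (ground-mapTy wk Ω g) ⊢e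
... | evaluates e↪ v le ⊢v = evaluates e↪ v (s≤s le) (∀I ⊢v)
evaluate-step (suc k) rec g (∀E B ⊢e) with rec ≤-refl g ⊢e
... | evaluates e↪ v le ⊢v = evaluates e↪ v (s≤s le) (∀E B ⊢v)

evaluate : Ground Ω → n ∣ Ω ⊢ e ∶ A ⟨ k ⟩ → Evaluates n Ω e A k
evaluate {k = k} = <-rec Evaluable evaluate-step k

emb : ∀ {n} → Ty n → Ty⁺ n
emb (tvar i) = tvar i
emb (A • B)  = emb A • emb B
emb (A ⧵ B)  = emb A ⧵ emb B
emb (A ↠ B)  = emb A ↠ emb B
emb (all A)  = all (emb A)

emb-rename : ∀ {m n} (ρ : Fin m → Fin n) (A : Ty m) → emb (rename ρ A) ≡ ren ρ (emb A)
emb-rename ρ (tvar i) = refl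
emb-rename ρ (A • B)  = cong₂ _•_ (emb-rename ρ A) (emb-rename ρ B)
emb-rename ρ (A ⧵ B)  = cong₂ _⧵_ (emb-rename ρ A) (emb-rename ρ B)
emb-rename ρ (A ↠ B)  = cong₂ _↠_ (emb-rename ρ A) (emb-rename ρ B)
emb-rename ρ (all A)  = cong all (emb-rename (ext ρ) A)

emb-tsubst : ∀ {m n} (σ : Fin m → Ty n) (A : Ty m) → emb (tsubst σ A) ≡ sub (emb ∘ σ) (emb A)
emb-tsubst σ (tvar i) = refl
emb-tsubst σ (A • B)  = cong₂ _•_ (emb-tsubst σ A) (emb-tsubst σ B)
emb-tsubst σ (A ⧵ B)  = cong₂ _⧵_ (emb-tsubst σ A) (emb-tsubst σ B)
emb-tsubst σ (A ↠ B)  = cong₂ _↠_ (emb-tsubst σ A) (emb-tsubst σ B)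
emb-tsubst σ (all A)  = cong all (trans (emb-tsubst (exts σ) A) (sub-cong commute (emb A)))
  where
  commute : emb ∘ exts σ ≗ exts⁺ (emb ∘ σ)
  commute zero    = refl
  commute (suc i) = emb-rename suc (σ i)

emb-[] : ∀ {n} (A : Ty (suc n)) (B : Ty n) → emb (A [ B ]ᵀ) ≡ emb A [ emb B ]⁺
emb-[] A B = trans (emb-tsubst _ A) (sub-cong (λ { zero → refl ; (suc i) → refl }) (emb A))

embCx : ∀ {n} → Ctx n → Cx⁺ n
embCx = map λ { (x , A) → decl x (emb A) }

embCx-++ : ∀ {n} (Ω₁ Ω₂ : Ctx n) → embCx (Ω₁ ++ Ω₂) ≡ embCx Ω₁ ++ embCx Ω₂
embCx-++ = map-++ _

names-embCx : ∀ {n} (Ω : Ctx n) → names (embCx Ω) ≡ map proj₁ Ω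
names-embCx []            = refl
names-embCx ((x , A) ∷ Ω) = cong (x ∷_) (names-embCx Ω)

embCx-wkCtx : ∀ {n} (Ω : Ctx n) → embCx (wkCtx Ω) ≡ wkCx⁺ (embCx Ω)
embCx-wkCtx []            = refl
embCx-wkCtx ((x , A) ∷ Ω) = cong₂ _∷_ (cong (decl x) (emb-rename suc A)) (embCx-wkCtx Ω)

distinct-embCx : ∀ {n} (Ω : Ctx n) → Distinct Ω → Distinct⁺ (embCx Ω)
distinct-embCx Ω = subst Unique (sym (names-embCx Ω))

distinct-embCx-++ : ∀ {n} (Ω₁ Ω₂ : Ctx n) → Distinct (Ω₁ ++ Ω₂) → Distinct⁺ (embCx Ω₁ ++ embCx Ω₂)
distinct-embCx-++ Ω₁ Ω₂ d = subst Distinct⁺ (embCx-++ Ω₁ Ω₂) (distinct-embCx (Ω₁ ++ Ω₂) d)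

⊢-embed : ∀ {n} {Ω : Ctx n} {e} {A : Ty n} → n ∣ Ω ⊢ e ∶ A → ∃ λ k → n ∣ embCx Ω ⊢ e ∶ emb A ⟨ k ⟩
⊢-embed hyp = _ , hyp
⊢-embed (↠I {Ω} {x} {A} d ⊢e) =
  _ , ↠I (distinct-embCx-++ Ω [ (x , A) ] d) (cast (embCx-++ Ω _) refl refl refl (proj₂ (⊢-embed ⊢e)))
⊢-embed (⧵I {Ω} {x} {A} d ⊢e) = _ , ⧵I (distinct-embCx ((x , A) ∷ Ω) d) (proj₂ (⊢-embed ⊢e))
⊢-embed (↠E {Ω₁} {Ω₂} d ⊢e₁ ⊢e₂) =
  _ , cast (sym (embCx-++ Ω₁ Ω₂)) refl refl refl
         (↠E (distinct-embCx-++ Ω₁ Ω₂ d) (proj₂ (⊢-embed ⊢e₁)) (proj₂ (⊢-embed ⊢e₂)))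
⊢-embed (⧵E {Ω₂} {Ω₁} d ⊢e₁ ⊢e₂) =
  _ , cast (sym (embCx-++ Ω₁ Ω₂)) refl refl refl
         (⧵E (distinct-embCx-++ Ω₁ Ω₂ d) (proj₂ (⊢-embed ⊢e₁)) (proj₂ (⊢-embed ⊢e₂)))
⊢-embed (•I {Ω₁} {Ω₂} d ⊢e₁ ⊢e₂) =
  _ , cast (sym (embCx-++ Ω₁ Ω₂)) refl refl refl
         (•I (distinct-embCx-++ Ω₁ Ω₂ d) (proj₂ (⊢-embed ⊢e₁)) (proj₂ (⊢-embed ⊢e₂)))
⊢-embed (•E {Ω} {ΩL} {ΩR} d d′ ⊢e ⊢e₁) =
  _ , cast (sym (map-++₃ _ ΩL Ω ΩR)) refl refl refl
         (•E (subst Distinct⁺ (map-++₃ _ ΩL Ω ΩR) (distinct-embCx (ΩL ++ Ω ++ ΩR) d))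
             (distinct-embCx-++ ΩL _ d′)
             (proj₂ (⊢-embed ⊢e))
             (cast (embCx-++ ΩL _) refl refl refl (proj₂ (⊢-embed ⊢e₁))))
⊢-embed (∀I {Ω} ⊢e) = _ , ∀I (cast (embCx-wkCtx Ω) refl refl refl (proj₂ (⊢-embed ⊢e)))
⊢-embed (∀E {A = A} B ⊢e) = _ , cast refl refl (sym (emb-[] A B)) refl (∀E (emb B) (proj₂ (⊢-embed ⊢e)))

mainTheorem4 : (e : Expr) →
    0 ∣ [] ⊢ e ∶ all (tvar zero ↠ (tvar zero ↠ (tvar zero • tvar zero))) →
    (v w : Expr) → Closed v → Value v → Closed w → Value w →
    app (app e v) w ↪ pair v w
mainTheorem4 e ⊢e v w cv vv cw vw with evaluate refl ⊢evw
  where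
  ⊢evw : 0 ∣ const v ∷ const w ∷ [] ⊢ app (app e v) w ∶ ι • ι ⟨ _ ⟩
  ⊢evw = ↠E [] (↠E [] (∀E ι (proj₂ (⊢-embed ⊢e))) (cst cv vv)) (cst cw vw)
... | evaluates e↪u u-val _ ⊢u with value-ι•ι u-val ⊢u
... | _ , _ , refl , refl = e↪u
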